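{- Let $t \ge 3$ be an integer and let $g$ denote the Sprague-Grundy function of the game \textsc{Mark}-$t$ in normal play. For every $k \in \{0,1,\ldots,t-2\}$ and every nonnegative integer $n$, we have $g(n) = k$ if and only if the base-$t$ representation $R(n)$ of $n$ ends with an odd number of trailing digits equal to $k$.
   Context: \textsc{Mark}-$t$ (for an integer $t\ge 2$) is the impartial game whose positions are the nonnegative integers; from a position $n \ge 1$ a move goes to any of $n-1, n-2, \ldots, n-(t-1)$ that is nonnegative, or to $\lfloor n/t \rfloor$; the position $0$ has no moves. In normal play the player unable to move loses. The Sprague-Grundy function is defined recursively by $g(n) = \operatorname{mex}\{g(m) : m \text{ an option of } n\}$, where $\operatorname{mex} S$ is the least nonnegative integer not in $S$. $R(n)$ denotes the usual base-$t$ representation of $n$ (without leading zeros, with $R(0)$ the single digit $0$). "The number of trailing $k$'s" of $R(n)$ is the length of the maximal final block of $R(n)$ consisting of the digit $k$. -}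

module Defs where

open import Data.Nat using (ℕ; zero; suc; _∸_; _<_; _≤_; _≤?_; _<?_; _≟_; NonZero)
open import Data.Nat.DivMod using (_/_; _%_)
open import Data.List using (List; []; _∷_; map; filter; applyUpTo; takeWhile; length)
open import Data.List.Membership.Propositional using (_∈_; _∉_)
open import Data.Product using (_×_)
open import Relation.Nullary using (yes; no)

options : (t : ℕ) → .{{NonZero t}} → ℕ → List ℕ
options t zero = []
options t n@(suc _) = (n / t) ∷ map (n ∸_) (filter (_≤? n) (applyUpTo suc (t ∸ 1)))

IsMex : ℕ → List ℕ → Set
IsMex m S = (m ∉ S) × (∀ j → j < m → j ∈ S)

-- g is the Sprague-Grundy function of Mark-t:  g(n) = mex { g(m) : m an option of n }
-- for every n (this recursion determines g uniquely).
IsSGFunction : (t : ℕ) → .{{NonZero t}} → (ℕ → ℕ) → Set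
IsSGFunction t g = ∀ n → IsMex (g n) (map g (options t n))

-- base-t digits of n, least significant first, with R(0) = [0].
-- The fuel argument (use fuel n+1) bounds the number of digits; it suffices when t ≥ 2.
digitsFuel : (t : ℕ) → .{{NonZero t}} → ℕ → ℕ → List ℕ
digitsFuel t zero    n = []
digitsFuel t (suc f) n with n <? t
... | yes _ = n ∷ []
... | no  _ = (n % t) ∷ digitsFuel t f (n / t)

digits : (t : ℕ) → .{{NonZero t}} → ℕ → List ℕ
digits t n = digitsFuel t (suc n) n

-- number of trailing digits equal to k in R(n) (= leading k's of the LSD-first list)
trailing : (t : ℕ) → .{{NonZero t}} → ℕ → ℕ → ℕ
trailing t k n = length (takeWhile (k ≟_) (digits t n))

-- Write n = d + q t with d the last base-t digit.  A subtraction move changes d, while division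
-- drops d, shortening a run of trailing d's by one.  A strong induction then gives both directions
-- at once: if n has an odd run of k's (so d = k), no option has value k but every j < k is the
-- value of either j + q t or q; conversely g n = k excludes k < d, an even run with d = k, and d < k.
module Submission where

open import Defs
open import Data.Nat using (ℕ; _≤_; _∸_; NonZero)
open import Data.Nat.DivMod using (_%_)
open import Relation.Binary.PropositionalEquality using (_≡_)
open import Function.Bundles using (_⇔_)

open import Function.Bundles using (module Equivalence; mk⇔)
open import Data.Nat using (zero; suc; pred; _+_; _*_; _<_; _<?_; _≤?_; _≟_; z≤n; s≤s; z<s; >-nonZero)
open import Data.Nat.Properties
open import Data.Nat.Induction using (<-rec)
open import Data.Nat.DivMod
open import Data.Nat.Divisibility using (_∣_; divides; ∣⇒≤; ∣m+n∣m⇒∣n; n∣m*n)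
open import Data.List using (List; []; _∷_; map; filter; applyUpTo; takeWhile; length)
open import Data.List.Membership.Propositional using (_∈_; _∉_)
open import Data.List.Membership.Propositional.Properties using (∈-map⁺; ∈-map⁻; ∈-filter⁺; ∈-filter⁻; ∈-applyUpTo⁺; ∈-applyUpTo⁻)
open import Data.List.Relation.Unary.Any using (here; there)
open import Data.Product using (∃; _×_; _,_; proj₁; proj₂)
open import Data.Sum using (inj₁; inj₂)
open import Data.Empty using (⊥-elim)
open import Function using (_∘_)
open import Relation.Unary using (Pred; Decidable)
open import Relation.Nullary using (¬_; Dec; yes; no; decidable-stable)
open import Relation.Binary.Definitions using (tri<; tri≈; tri>)
open import Relation.Binary.PropositionalEquality using (_≢_; refl; sym; trans; cong; cong₂; subst; module ≡-Reasoning)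

suc-odd⇒¬odd : ∀ x → suc x % 2 ≡ 1 → x % 2 ≢ 1
suc-odd⇒¬odd (suc zero)    ()
suc-odd⇒¬odd (suc (suc x)) = suc-odd⇒¬odd x

¬suc-odd⇒odd : ∀ x → suc x % 2 ≢ 1 → x % 2 ≡ 1
¬suc-odd⇒odd zero          h = ⊥-elim (h refl)
¬suc-odd⇒odd (suc zero)    h = refl
¬suc-odd⇒odd (suc (suc x)) h = ¬suc-odd⇒odd x h

module _ {a p} {A : Set a} {P : Pred A p} (P? : Decidable P) where

  takeWhile-∷-accept : ∀ {x} xs → P x → takeWhile P? (x ∷ xs) ≡ x ∷ takeWhile P? xs
  takeWhile-∷-accept {x} xs px with P? x
  ... | yes _   = refl
  ... | no ¬px  = ⊥-elim (¬px px)

  takeWhile-∷-reject : ∀ {x} xs → ¬ P x → takeWhile P? (x ∷ xs) ≡ []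
  takeWhile-∷-reject {x} xs ¬px with P? x
  ... | yes px = ⊥-elim (¬px px)
  ... | no _   = refl

module _ {t : ℕ} .{{_ : NonZero t}} where
  open ≡-Reasoning

  [r+qt]%t≡r : ∀ {r} q → r < t → (r + q * t) % t ≡ r
  [r+qt]%t≡r {r} q r<t = trans ([m+kn]%n≡m%n r q t) (m<n⇒m%n≡m r<t)

  [r+qt]/t≡q : ∀ {r} q → r < t → (r + q * t) / t ≡ q
  [r+qt]/t≡q {r} q r<t = begin
    (r + q * t) / t    ≡⟨ +-distrib-/-∣ʳ r (n∣m*n q) ⟩
    r / t + q * t / t  ≡⟨ cong₂ _+_ (m<n⇒m/n≡0 r<t) (m*n/n≡m q t) ⟩
    q                  ∎

  [i+m]%t≢m%t : ∀ {i} m → 0 < i → i < t → (i + m) % t ≢ m % t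
  [i+m]%t≢m%t {i} m 0<i i<t eq = <⇒≱ i<t (∣⇒≤ {{>-nonZero 0<i}} t∣i)
    where
    r x y : ℕ
    r = m % t
    x = m / t
    y = (i + m) / t
    yt≡xt+i : y * t ≡ x * t + i
    yt≡xt+i = +-cancelˡ-≡ r _ _ (begin
      r + y * t            ≡⟨ cong (_+ y * t) eq ⟨
      (i + m) % t + y * t  ≡⟨ m≡m%n+[m/n]*n (i + m) t ⟨
      i + m                ≡⟨ cong (i +_) (m≡m%n+[m/n]*n m t) ⟩
      i + (r + x * t)      ≡⟨ +-comm i _ ⟩
      r + x * t + i        ≡⟨ +-assoc r _ i ⟩
      r + (x * t + i)      ∎)
    t∣i : t ∣ i
    t∣i = ∣m+n∣m⇒∣n (divides y (sym yt≡xt+i)) (n∣m*n x)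

  [n/t]%t≢n%t : ∀ {n} → 0 < n → n < t → (n / t) % t ≢ n % t
  [n/t]%t≢n%t {n} 0<n n<t eq = <⇒≢ 0<n (begin
    0            ≡⟨ m<n⇒m%n≡m (≤-<-trans z≤n n<t) ⟨
    0 % t        ≡⟨ cong (_% t) (m<n⇒m/n≡0 n<t) ⟨
    (n / t) % t  ≡⟨ eq ⟩
    n % t        ≡⟨ m<n⇒m%n≡m n<t ⟩
    n            ∎)

  %≡⇒[1+n]%≡ : ∀ {n r} → n % t ≡ r → suc r < t → suc n % t ≡ suc r
  %≡⇒[1+n]%≡ {n} {r} n%t≡r 1+r<t = begin
    suc n % t                   ≡⟨ cong (λ x → suc x % t) (m≡m%n+[m/n]*n n t) ⟩
    suc (n % t + n / t * t) % t ≡⟨ cong (λ x → (suc x + n / t * t) % t) n%t≡r ⟩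
    (suc r + n / t * t) % t     ≡⟨ [r+qt]%t≡r (n / t) 1+r<t ⟩
    suc r                       ∎

module Digits {t : ℕ} .{{_ : NonZero t}} (1<t : 1 < t) where

  0<t : 0 < t
  0<t = <-trans z<s 1<t

  n/t<n : ∀ {n} → 0 < n → n / t < n
  n/t<n {suc n} _ = m/n<m (suc n) t 1<t

  digitsFuel-irrelevant : ∀ {f f′} n → n < f → n < f′ → digitsFuel t f n ≡ digitsFuel t f′ n
  digitsFuel-irrelevant {suc f} {suc f′} n (s≤s n≤f) (s≤s n≤f′) with n <? t
  ... | yes _  = refl
  ... | no n≮t = cong (n % t ∷_) (digitsFuel-irrelevant (n / t)
                   (<-≤-trans q<n n≤f) (<-≤-trans q<n n≤f′))
    where
    q<n : n / t < n
    q<n = n/t<n (<-≤-trans 0<t (≮⇒≥ n≮t))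

  digits-< : ∀ {n} → n < t → digits t n ≡ n ∷ []
  digits-< {n} n<t with n <? t
  ... | yes _  = refl
  ... | no n≮t = ⊥-elim (n≮t n<t)

  digits-≥ : ∀ {n} → t ≤ n → digits t n ≡ n % t ∷ digits t (n / t)
  digits-≥ {n} t≤n with n <? t
  ... | yes n<t = ⊥-elim (<⇒≱ n<t t≤n)
  ... | no _    = cong (n % t ∷_) (digitsFuel-irrelevant (n / t) (n/t<n (<-≤-trans 0<t t≤n)) (n<1+n _))

  trailing-≢ : ∀ {k} n → n % t ≢ k → trailing t k n ≡ 0
  trailing-≢ {k} n n%t≢k with <-≤-connex n t
  ... | inj₁ n<t rewrite digits-< n<t | m<n⇒m%n≡m n<t =
    cong length (takeWhile-∷-reject (k ≟_) [] (n%t≢k ∘ sym))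
  ... | inj₂ t≤n rewrite digits-≥ t≤n =
    cong length (takeWhile-∷-reject (k ≟_) _ (n%t≢k ∘ sym))

  trailing-single : ∀ {n} → n < t → trailing t n n ≡ 1
  trailing-single {n} n<t rewrite digits-< n<t = cong length (takeWhile-∷-accept (n ≟_) [] refl)

  trailing-≥ : ∀ {k n} → t ≤ n → n % t ≡ k →
               trailing t k n ≡ suc (trailing t k (n / t))
  trailing-≥ {k} {n} t≤n n%t≡k rewrite digits-≥ t≤n =
    cong length (takeWhile-∷-accept (k ≟_) _ (sym n%t≡k))

  OddTrailing : ℕ → ℕ → Set
  OddTrailing k n = trailing t k n % 2 ≡ 1

  oddTrailing⇒%≡ : ∀ {k n} → OddTrailing k n → n % t ≡ k
  oddTrailing⇒%≡ {k} {n} odd with n % t ≟ k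
  ... | yes n%t≡k = n%t≡k
  ... | no n%t≢k  = ⊥-elim (0≢1+n (subst (λ x → x % 2 ≡ 1) (trailing-≢ n n%t≢k) odd))

  oddTrailing⇒¬oddTrailing-/ : ∀ {k n} → t ≤ n → OddTrailing k n → ¬ OddTrailing k (n / t)
  oddTrailing⇒¬oddTrailing-/ t≤n odd =
    suc-odd⇒¬odd (trailing t _ (_ / t)) (subst (λ x → x % 2 ≡ 1) (trailing-≥ t≤n (oddTrailing⇒%≡ odd)) odd)

  ¬oddTrailing⇒oddTrailing-/ : ∀ {k n} → n % t ≡ k → ¬ OddTrailing k n →
                               t ≤ n × OddTrailing k (n / t)
  ¬oddTrailing⇒oddTrailing-/ {k} {n} n%t≡k ¬odd with <-≤-connex n t
  ... | inj₁ n<t rewrite sym n%t≡k | m<n⇒m%n≡m n<t =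
    ⊥-elim (¬odd (cong (_% 2) (trailing-single n<t)))
  ... | inj₂ t≤n =
    t≤n , ¬suc-odd⇒odd (trailing t k (n / t)) (¬odd ∘ subst (λ x → x % 2 ≡ 1) (sym (trailing-≥ t≤n n%t≡k)))

  ¬oddTrailing-digit⇒oddTrailing : ∀ {r} q → r < t → ¬ OddTrailing r (r + q * t) → OddTrailing r q
  ¬oddTrailing-digit⇒oddTrailing q r<t ¬odd = subst (OddTrailing _) ([r+qt]/t≡q q r<t)
    (proj₂ (¬oddTrailing⇒oddTrailing-/ ([r+qt]%t≡r q r<t) ¬odd))

  oddTrailing? : ∀ k n → Dec (OddTrailing k n)
  oddTrailing? k n = trailing t k n % 2 ≟ 1

IsMex-unique : ∀ {a b S} → IsMex a S → IsMex b S → a ≡ b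
IsMex-unique {a} {b} (a∉S , <a⇒∈S) (b∉S , <b⇒∈S) with <-cmp a b
... | tri< a<b _ _ = ⊥-elim (a∉S (<b⇒∈S a a<b))
... | tri≈ _ a≡b _ = a≡b
... | tri> _ _ b<a = ⊥-elim (b∉S (<a⇒∈S b b<a))

module Mark {t : ℕ} .{{_ : NonZero t}} (1<t : 1 < t) where
  open Digits 1<t

  data Move : ℕ → ℕ → Set where
    take   : ∀ {i} m → 0 < i → i < t → Move (i + m) m
    divide : ∀ {n} → 0 < n → Move n (n / t)

  Move⇒< : ∀ {n m} → Move n m → m < n
  Move⇒< (take m 0<i _) = m<n+m m 0<i
  Move⇒< (divide 0<n)   = n/t<n 0<n

  Move⇒∈options : ∀ {n m} → Move n m → m ∈ options t n
  Move⇒∈options (take {suc i} m _ i<t) = there (subst (_∈ map (n ∸_) steps) (m+n∸m≡n (suc i) m)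
    (∈-map⁺ (n ∸_) (∈-filter⁺ (_≤? n) (∈-applyUpTo⁺ suc (∸-monoˡ-≤ 1 i<t)) (s≤s (m≤m+n i m)))))
    where
    n : ℕ
    n = suc i + m
    steps : List ℕ
    steps = filter (_≤? n) (applyUpTo suc (t ∸ 1))
  Move⇒∈options (divide {suc n} _)     = here refl

  ∈options⇒Move : ∀ {n m} → m ∈ options t n → Move n m
  ∈options⇒Move {suc n} (here refl) = divide z<s
  ∈options⇒Move {suc n} (there m∈)
    with i , i∈ , refl ← ∈-map⁻ (suc n ∸_) m∈
    with i∈upTo , i≤n ← ∈-filter⁻ (_≤? suc n) {xs = applyUpTo suc (t ∸ 1)} i∈
    with j , j<t∸1 , refl ← ∈-applyUpTo⁻ suc {n = t ∸ 1} i∈upTo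
    = subst (λ n′ → Move n′ (suc n ∸ suc j)) (m+[n∸m]≡n i≤n)
        (take _ z<s (≤-trans (s≤s j<t∸1) (≤-reflexive (m+[n∸m]≡n 0<t))))

  take-between : ∀ {a b x} → a < b → b < a + t → Move (b + x) (a + x)
  take-between {a} {b} {x} a<b b<a+t = subst (λ n → Move n (a + x)) b∸a+[a+x]≡b+x
    (take (a + x) (m<n⇒0<n∸m a<b) (m<n+o⇒m∸n<o b a b<a+t))
    where
    b∸a+[a+x]≡b+x : b ∸ a + (a + x) ≡ b + x
    b∸a+[a+x]≡b+x = trans (sym (+-assoc (b ∸ a) a x)) (cong (_+ x) (m∸n+n≡m (<⇒≤ a<b)))

  module SpragueGrundy (g : ℕ → ℕ) (g-sg : IsSGFunction t g) where

    optionValues : ℕ → List ℕ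
    optionValues n = map g (options t n)

    Move⇒∈optionValues : ∀ {n m} → Move n m → g m ∈ optionValues n
    Move⇒∈optionValues = ∈-map⁺ g ∘ Move⇒∈options

    ∈optionValues⇒Move : ∀ {n x} → x ∈ optionValues n → ∃ λ m → Move n m × x ≡ g m
    ∈optionValues⇒Move x∈ with m , m∈ , x≡gm ← ∈-map⁻ g x∈ = m , ∈options⇒Move m∈ , x≡gm

    Characterised : ℕ → Set
    Characterised n = ∀ {k} → suc k < t → g n ≡ k ⇔ OddTrailing k n

    Below : ℕ → Set
    Below n = ∀ {m} → m < n → Characterised m

    take-value≢residue : ∀ {i m k} → Below (i + m) → 0 < i → i < t → suc k < t →
                         g m ≡ k → (i + m) % t ≢ k
    take-value≢residue {m = m} {k} ih 0<i i<t 1+k<t gm≡k [i+m]%t≡k =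
      [i+m]%t≢m%t m 0<i i<t (trans [i+m]%t≡k (sym m%t≡k))
      where
      m%t≡k : m % t ≡ k
      m%t≡k = oddTrailing⇒%≡ (Equivalence.to (ih (m<n+m m 0<i) 1+k<t) gm≡k)

    oddTrailing-move⇒∈optionValues : ∀ {n m k} → Below n → suc k < t → Move n m → OddTrailing k m →
                               k ∈ optionValues n
    oddTrailing-move⇒∈optionValues ih 1+k<t move odd =
      subst (_∈ optionValues _) (Equivalence.from (ih (Move⇒< move) 1+k<t) odd) (Move⇒∈optionValues move)

    -- The digit j sits below the last digit of n = d + q t, so n can move to j + q t;
    -- if that position does not have an odd run of j's, then q does.
    <residue⇒∈optionValues : ∀ {n j} → Below n → j < n % t → j ∈ optionValues n
    <residue⇒∈optionValues {n} {j} ih j<d = by-cases (oddTrailing? j (j + q * t))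
      where
      q : ℕ
      q = n / t
      1+j<t : suc j < t
      1+j<t = ≤-<-trans j<d (m%n<n n t)
      by-cases : Dec (OddTrailing j (j + q * t)) → j ∈ optionValues n
      by-cases (yes odd) = oddTrailing-move⇒∈optionValues ih 1+j<t move odd
        where
        move : Move n (j + q * t)
        move = subst (λ n′ → Move n′ (j + q * t)) (sym (m≡m%n+[m/n]*n n t))
                 (take-between j<d (<-≤-trans (m%n<n n t) (m≤n+m t j)))
      by-cases (no ¬odd) = oddTrailing-move⇒∈optionValues ih 1+j<t
        (divide (<-≤-trans (≤-<-trans z≤n j<d) (m%n≤m n t)))
        (¬oddTrailing-digit⇒oddTrailing q (<-trans (n<1+n j) 1+j<t) ¬odd)

    oddTrailing⇒move-value≢ : ∀ {n m k} → Below n → suc k < t → OddTrailing k n → Move n m → g m ≢ k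
    oddTrailing⇒move-value≢ ih 1+k<t odd (take m 0<i i<t) gm≡k =
      take-value≢residue ih 0<i i<t 1+k<t gm≡k (oddTrailing⇒%≡ odd)
    oddTrailing⇒move-value≢ {n} ih 1+k<t odd (divide 0<n) gq≡k
      with <-≤-connex n t | Equivalence.to (ih (n/t<n 0<n) 1+k<t) gq≡k
    ... | inj₁ n<t | odd-q = [n/t]%t≢n%t 0<n n<t (trans (oddTrailing⇒%≡ odd-q) (sym (oddTrailing⇒%≡ odd)))
    ... | inj₂ t≤n | odd-q = oddTrailing⇒¬oddTrailing-/ t≤n odd odd-q

    oddTrailing⇒∉optionValues : ∀ {n k} → Below n → suc k < t → OddTrailing k n → k ∉ optionValues n
    oddTrailing⇒∉optionValues ih 1+k<t odd k∈ with m , move , k≡gm ← ∈optionValues⇒Move k∈ =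
      oddTrailing⇒move-value≢ ih 1+k<t odd move (sym k≡gm)

    residue-value⇒oddTrailing : ∀ {n k} → Below n → suc k < t → n % t ≡ k → g n ≡ k → OddTrailing k n
    residue-value⇒oddTrailing {n} ih 1+k<t d≡k gn≡k = decidable-stable (oddTrailing? _ n) λ ¬odd →
      let t≤n , odd-q = ¬oddTrailing⇒oddTrailing-/ d≡k ¬odd in
      proj₁ (g-sg n) (subst (_∈ optionValues n) (sym gn≡k)
        (oddTrailing-move⇒∈optionValues ih 1+k<t (divide (<-≤-trans 0<t t≤n)) odd-q))

    -- Write n = (d + t) + q′ t with q = 1 + q′, and move to k + q′ t.  If that position had
    -- no odd run of k's, q′ would end in k, so q would end in k + 1 ≠ d.
    quotient-residue⇒∈optionValues : ∀ {n k} → Below n → suc k < t → n % t < k → t ≤ n →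
                               (n / t) % t ≡ n % t → k ∈ optionValues n
    quotient-residue⇒∈optionValues {n} {k} ih 1+k<t d<k t≤n q%t≡d = oddTrailing-move⇒∈optionValues ih 1+k<t move odd
      where
      d q′ : ℕ
      d  = n % t
      q′ = pred (n / t)
      k<t : k < t
      k<t = <-trans (n<1+n k) 1+k<t
      1+q′≡q : suc q′ ≡ n / t
      1+q′≡q = suc-pred (n / t) {{>-nonZero (m≥n⇒m/n>0 t≤n)}}
      n≡[d+t]+q′t : n ≡ (d + t) + q′ * t
      n≡[d+t]+q′t = begin
        n                 ≡⟨ m≡m%n+[m/n]*n n t ⟩
        d + n / t * t     ≡⟨ cong (λ q → d + q * t) 1+q′≡q ⟨
        d + (t + q′ * t)  ≡⟨ +-assoc d t (q′ * t) ⟨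
        (d + t) + q′ * t  ∎
        where open ≡-Reasoning
      move : Move n (k + q′ * t)
      move = subst (λ n′ → Move n′ (k + q′ * t)) (sym n≡[d+t]+q′t)
               (take-between (<-≤-trans k<t (m≤n+m t d)) (+-monoˡ-< t d<k))
      d≡1+k : ¬ OddTrailing k (k + q′ * t) → d ≡ suc k
      d≡1+k ¬odd = begin
        d               ≡⟨ q%t≡d ⟨
        (n / t) % t     ≡⟨ cong (_% t) 1+q′≡q ⟨
        suc q′ % t      ≡⟨ %≡⇒[1+n]%≡ (oddTrailing⇒%≡ (¬oddTrailing-digit⇒oddTrailing q′ k<t ¬odd)) 1+k<t ⟩
        suc k           ∎
        where open ≡-Reasoning
      odd : OddTrailing k (k + q′ * t)
      odd = decidable-stable (oddTrailing? k (k + q′ * t))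
              λ ¬odd → <-asym d<k (subst (k <_) (sym (d≡1+k ¬odd)) (n<1+n k))

    value>residue⇒move-value≢residue : ∀ {n m k} → Below n → suc k < t → n % t < k → g n ≡ k →
                                       Move n m → g m ≢ n % t
    value>residue⇒move-value≢residue ih 1+k<t d<k _ (take m 0<i i<t) gm≡d =
      take-value≢residue ih 0<i i<t (<-trans (s≤s d<k) 1+k<t) gm≡d refl
    value>residue⇒move-value≢residue {n} ih 1+k<t d<k gn≡k (divide 0<n) gq≡d
      with <-≤-connex n t | oddTrailing⇒%≡ (Equivalence.to (ih (n/t<n 0<n) (<-trans (s≤s d<k) 1+k<t)) gq≡d)
    ... | inj₁ n<t | q%t≡d = [n/t]%t≢n%t 0<n n<t q%t≡d
    ... | inj₂ t≤n | q%t≡d = proj₁ (g-sg n) (subst (_∈ optionValues n) (sym gn≡k)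
                               (quotient-residue⇒∈optionValues ih 1+k<t d<k t≤n q%t≡d))

    residue<value⇒⊥ : ∀ {n k} → Below n → suc k < t → n % t < k → g n ≢ k
    residue<value⇒⊥ {n} ih 1+k<t d<k gn≡k
      with m , move , d≡gm ← ∈optionValues⇒Move (proj₂ (g-sg n) (n % t) (subst (n % t <_) (sym gn≡k) d<k)) =
      value>residue⇒move-value≢residue ih 1+k<t d<k gn≡k move (sym d≡gm)

    oddTrailing⇒value : ∀ {n k} → Below n → suc k < t → OddTrailing k n → g n ≡ k
    oddTrailing⇒value {n} ih 1+k<t odd = IsMex-unique (g-sg n) (oddTrailing⇒∉optionValues ih 1+k<t odd , <k⇒∈optionValues)
      where
      <k⇒∈optionValues : ∀ j → j < _ → j ∈ optionValues n
      <k⇒∈optionValues j j<k = <residue⇒∈optionValues ih (subst (j <_) (sym (oddTrailing⇒%≡ odd)) j<k)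

    value⇒oddTrailing : ∀ {n k} → Below n → suc k < t → g n ≡ k → OddTrailing k n
    value⇒oddTrailing {n} {k} ih 1+k<t gn≡k with <-cmp (n % t) k
    ... | tri< d<k _ _ = ⊥-elim (residue<value⇒⊥ ih 1+k<t d<k gn≡k)
    ... | tri≈ _ d≡k _ = residue-value⇒oddTrailing ih 1+k<t d≡k gn≡k
    ... | tri> _ _ k<d = ⊥-elim (proj₁ (g-sg n) (subst (_∈ optionValues n) (sym gn≡k) (<residue⇒∈optionValues ih k<d)))

    value⇔oddTrailing : ∀ n → Characterised n
    value⇔oddTrailing = <-rec Characterised λ n ih 1+k<t →
      mk⇔ (value⇒oddTrailing ih 1+k<t) (oddTrailing⇒value ih 1+k<t)

theorem1 : (t : ℕ) → .{{_ : NonZero t}} → 3 ≤ t → (g : ℕ → ℕ) → IsSGFunction t g →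
             (k : ℕ) → k ≤ t ∸ 2 → (n : ℕ) →
             (g n ≡ k) ⇔ (trailing t k n % 2 ≡ 1)
theorem1 t t≥3 g g-sg k k≤t∸2 n = value⇔oddTrailing n 1+k<t
  where
  2≤t : 2 ≤ t
  2≤t = ≤-trans (s≤s (s≤s z≤n)) t≥3
  open Mark 2≤t
  open SpragueGrundy g g-sg
  1+k<t : suc k < t
  1+k<t = subst (_≤ t) (+-comm k 2) (m≤o∸n⇒m+n≤o k 2≤t k≤t∸2)
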